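{- If $n\equiv 0\pmod 4$, then any two graphs in $\mathcal{K}_n$ are connected by a path in $\mathcal{G}_n^*$.
   Context: $\mathcal{G}_n$ is the set of simple 3-regular graphs on vertex set $[n]$. A make move ${\tt make}(yxvwz)$ applies to $G=(V,E)$ when $y,x,v,w,z$ are distinct, $yx,xv,vw,wz\in E$ and $xw,yz\notin E$, and replaces $E$ by $(E\setminus\{xy,wz\})\cup\{xw,yz\}$. A break move ${\tt break}(vxw,yz)$ applies when $vxwv$ is a triangle, $yz\in E$, $\{y,z\}\cap\{v,x,w\}=\emptyset$ and $xy,wz\notin E$, and replaces $E$ by $(E\setminus\{xw,yz\})\cup\{xy,wz\}$. $\mathcal{G}_n^*$ is the graph on vertex set $\mathcal{G}_n$ with $G,G'$ adjacent iff a make or break move takes $G$ to $G'$. $\mathcal{K}_n$ is the set of graphs in $\mathcal{G}_n$ consisting of $n/4$ connected components each isomorphic to $K_4$. -}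

module Defs where

open import Data.Nat using (ℕ; zero; suc; _+_)
open import Data.Bool using (Bool; true; false; if_then_else_)
open import Data.Fin using (Fin)
open import Data.List using (List; map; allFin)
open import Data.Nat.ListAction using (sum)
open import Data.Product using (Σ; ∃; _×_; _,_)
open import Data.Sum using (_⊎_)
open import Relation.Nullary using (¬_)
open import Relation.Binary.PropositionalEquality using (_≡_; _≢_)
open import Relation.Binary.Construct.Closure.ReflexiveTransitive using (Star)
open import Function.Bundles using (_⇔_)

record Graph (n : ℕ) : Set where
  constructor mkGraph
  field
    adj : Fin n → Fin n → Bool
open Graph public

Edge : ∀ {n} → Graph n → Fin n → Fin n → Set
Edge G u v = adj G u v ≡ true

degree : ∀ {n} → Graph n → Fin n → ℕ
degree {n} G u = sum (map (λ v → if adj G u v then 1 else 0) (allFin n))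

IsSimple : ∀ {n} → Graph n → Set
IsSimple G = (∀ u v → adj G u v ≡ adj G v u) × (∀ u → adj G u u ≡ false)

InG : ∀ {n} → Graph n → Set
InG G = IsSimple G × (∀ u → degree G u ≡ 3)

SamePair : ∀ {n} → Fin n → Fin n → Fin n → Fin n → Set
SamePair a b x y = (a ≡ x × b ≡ y) ⊎ (a ≡ y × b ≡ x)

Switch : ∀ {n} → Graph n → Graph n →
         (p₁ q₁ p₂ q₂ r₁ s₁ r₂ s₂ : Fin n) → Set
Switch {n} G G' p₁ q₁ p₂ q₂ r₁ s₁ r₂ s₂ =
  ∀ (a b : Fin n) →
    Edge G' a b ⇔
      ((Edge G a b × ¬ SamePair a b p₁ q₁ × ¬ SamePair a b p₂ q₂)
        ⊎ SamePair a b r₁ s₁ ⊎ SamePair a b r₂ s₂)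

Distinct5 : ∀ {n} → Fin n → Fin n → Fin n → Fin n → Fin n → Set
Distinct5 a b c d e =
  a ≢ b × a ≢ c × a ≢ d × a ≢ e × b ≢ c × b ≢ d × b ≢ e ×
  c ≢ d × c ≢ e × d ≢ e

Make : ∀ {n} → Graph n → Graph n → Set
Make {n} G G' = Σ (Fin n) λ y → Σ (Fin n) λ x → Σ (Fin n) λ v →
  Σ (Fin n) λ w → Σ (Fin n) λ z →
    Distinct5 y x v w z ×
    Edge G y x × Edge G x v × Edge G v w × Edge G w z ×
    ¬ Edge G x w × ¬ Edge G y z ×
    Switch G G' x y w z x w y z

Break : ∀ {n} → Graph n → Graph n → Set
Break {n} G G' = Σ (Fin n) λ v → Σ (Fin n) λ x → Σ (Fin n) λ w →
  Σ (Fin n) λ y → Σ (Fin n) λ z →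
    (v ≢ x × v ≢ w × x ≢ w × y ≢ z) ×
    Edge G v x × Edge G x w × Edge G w v × Edge G y z ×
    (y ≢ v × y ≢ x × y ≢ w × z ≢ v × z ≢ x × z ≢ w) ×
    ¬ Edge G x y × ¬ Edge G w z ×
    Switch G G' x w y z x y w z

Move : ∀ {n} → Graph n → Graph n → Set
Move G G' = Make G G' ⊎ Break G G'

Adj* : ∀ {n} → Graph n → Graph n → Set
Adj* G G' = InG G × InG G' × (Move G G' ⊎ Move G' G)

SameGraph : ∀ {n} → Graph n → Graph n → Set
SameGraph G H = ∀ a b → adj G a b ≡ adj H a b

Connected* : ∀ {n} → Graph n → Graph n → Set
Connected* {n} G H = Σ (Graph n) λ H' → Star Adj* G H' × SameGraph H' H

Reach : ∀ {n} → Graph n → Fin n → Fin n → Set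
Reach G = Star (Edge G)

ComponentIsK4 : ∀ {n} → Graph n → Fin n → Set
ComponentIsK4 {n} G u = Σ (Fin n) λ a → Σ (Fin n) λ b → Σ (Fin n) λ c →
  Σ (Fin n) λ d →
    (a ≢ b × a ≢ c × a ≢ d × b ≢ c × b ≢ d × c ≢ d) ×
    (∀ t → Reach G u t ⇔ (t ≡ a ⊎ t ≡ b ⊎ t ≡ c ⊎ t ≡ d)) ×
    (Edge G a b × Edge G a c × Edge G a d × Edge G b c × Edge G b d × Edge G c d)

InK : ∀ {n} → Graph n → Set
InK G = InG G × (∀ u → ComponentIsK4 G u)

module Submission where

-- Call G ∈ 𝒢_n a clique graph if adjacency is transitive on distinct
-- vertices, i.e. every component is a K₄; every graph of 𝒦_n is one.
-- The key move is a swap: if N[u] and N[h] are two different K₄-components,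
-- and g ∈ N[u], then one break and two makes exchange g and h between them.
-- This is verified once and for all on an 8-vertex pattern by evaluation,
-- and transported into G by planting the pattern on N[u] ∪ N[h]; since these
-- vertices form a union of components, regularity, transitivity and moves
-- of the pattern carry over to the planted graphs.
-- Given the target H, the vertices are then fixed one at a time: for each
-- H-edge uh missing at u, swap h with a neighbour g of u that is not an
-- H-neighbour.  Vertices already agreeing with H lie in other components and
-- are untouched, so after n rounds the current graph is H.

open import Defs
open import Data.Nat using (ℕ; zero; suc; _+_; _<_; _≤_; _%_; _≡ᵇ_)
open import Data.Nat.Properties using (+-suc; suc-injective; m<1+n⇒m<n∨m≡n; ≤-refl; <⇒≤)
  renaming (_≟_ to _≟ℕ_)
open import Data.Bool using (Bool; true; false; if_then_else_; not; _∧_; _∨_)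
open import Data.Bool.Properties using (⇔→≡; ¬-not; not-¬) renaming (_≟_ to _≟ᵇ_)
open import Data.Bool.ListAction using (any)
open import Data.Fin using (Fin; zero; suc; toℕ; fromℕ<; splitAt; join; #_)
open import Data.Fin.Properties
  using (_≟_; any?; all?; join-splitAt; splitAt-join; toℕ<n; toℕ-fromℕ<; toℕ-injective)
open import Data.List using (List; []; _∷_; map; tabulate)
open import Data.Nat.ListAction using (sum)
open import Data.Vec using ([]; _∷_; lookup)
open import Data.Vec.Relation.Unary.All using ([]; _∷_)
open import Data.Vec.Relation.Unary.AllPairs using ([]; _∷_)
open import Data.Vec.Relation.Unary.Unique.Propositional.Properties using (lookup-injective)
open import Data.Product using (Σ; _×_; _,_; proj₁; proj₂)
import Data.Product as Prod
open import Data.Product.Function.NonDependent.Propositional using (_×-⇔_)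
open import Data.Sum using (_⊎_; inj₁; inj₂; [_,_]′)
import Data.Sum as Sum
open import Data.Sum.Function.Propositional using (_⊎-⇔_)
open import Data.Empty using (⊥; ⊥-elim)
open import Relation.Nullary using (¬_; Dec; yes; no; does; ¬?)
open import Relation.Nullary.Decidable using (_×-dec_; _⊎-dec_; _→-dec_; map′; from-yes)
open import Relation.Binary.PropositionalEquality
open import Relation.Binary.Construct.Closure.ReflexiveTransitive using (Star; ε; _◅_; _◅◅_)
open import Function using (_∘_; const)
open import Function.Bundles using (_⇔_; mk⇔; Equivalence)
open import Function.Properties.Equivalence using () renaming (trans to ⇔-trans; sym to ⇔-sym)
open import Function.Related.TypeIsomorphisms using (¬-cong-⇔)

count : ∀ {n} → (Fin n → Bool) → ℕ
count {zero}  f = 0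
count {suc n} f = (if f zero then 1 else 0) + count (f ∘ suc)

degree-count : ∀ {n} (G : Graph n) u → degree G u ≡ count (adj G u)
degree-count {n} G u = over (λ v → v)
  where
  over : ∀ {m} (g : Fin m → Fin n) →
    sum (map (λ v → if adj G u v then 1 else 0) (tabulate g)) ≡ count (adj G u ∘ g)
  over {zero}  g = refl
  over {suc m} g = cong ((if adj G u (g zero) then 1 else 0) +_) (over (g ∘ suc))

count-cong : ∀ {n} {f g : Fin n → Bool} → (∀ v → f v ≡ g v) → count f ≡ count g
count-cong {zero}  f≗g = refl
count-cong {suc n} f≗g =
  cong₂ _+_ (cong (λ b → if b then 1 else 0) (f≗g zero)) (count-cong (f≗g ∘ suc))

remove : ∀ {n} → (Fin n → Bool) → Fin n → Fin n → Bool
remove f p v = if does (v ≟ p) then false else f v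

remove-other : ∀ {n} (f : Fin n → Bool) {p v} → v ≢ p → remove f p v ≡ f v
remove-other f {p} {v} v≢p with v ≟ p
... | yes v≡p = ⊥-elim (v≢p v≡p)
... | no  _   = refl

remove-true : ∀ {n} (f : Fin n → Bool) {p v} → remove f p v ≡ true → f v ≡ true × v ≢ p
remove-true f {p} {v} fv with v ≟ p
... | no v≢p = fv , v≢p
... | yes _ with () ← fv

count-remove : ∀ {n} (f : Fin n → Bool) {p} → f p ≡ true → count f ≡ suc (count (remove f p))
count-remove {suc n} f {zero}  fp rewrite fp = refl
count-remove {suc n} f {suc p} fp =
  trans (cong ((if f zero then 1 else 0) +_) (count-remove (f ∘ suc) fp))
        (+-suc (if f zero then 1 else 0) _)

count-witness : ∀ {n} (f : Fin n → Bool) {m} → count f ≡ suc m → Σ (Fin n) λ p → f p ≡ true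
count-witness {suc n} f c with f zero in fz
... | true  = zero , fz
... | false = let (p , fp) = count-witness (f ∘ suc) c in suc p , fp

count-zero : ∀ {n} (f : Fin n → Bool) → count f ≡ 0 → ∀ v → f v ≡ false
count-zero f c v with f v in fv
... | false = refl
... | true with () ← trans (sym c) (count-remove f fv)

count-empty : ∀ {n} (f : Fin n → Bool) → (∀ v → f v ≡ false) → count f ≡ 0
count-empty {zero}  f none = refl
count-empty {suc n} f none rewrite none zero = count-empty (f ∘ suc) (none ∘ suc)

record Exactly3 {n} (f : Fin n → Bool) (p q r : Fin n) : Set where
  constructor exactly3
  field
    distinct : p ≢ q × p ≢ r × q ≢ r
    holds    : f p ≡ true × f q ≡ true × f r ≡ true
    only     : ∀ t → f t ≡ true → t ≡ p ⊎ t ≡ q ⊎ t ≡ r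

exactly3-rotate : ∀ {n} {f : Fin n → Bool} {p q r} → Exactly3 f p q r → Exactly3 f q r p
exactly3-rotate {f = f} {p} {q} {r} (exactly3 (p≢q , p≢r , q≢r) (fp , fq , fr) only) =
  exactly3 (q≢r , (λ q≡p → p≢q (sym q≡p)) , (λ r≡p → p≢r (sym r≡p))) (fq , fr , fp) rotated
  where
  rotated : ∀ t → f t ≡ true → t ≡ q ⊎ t ≡ r ⊎ t ≡ p
  rotated t ft with only t ft
  ... | inj₁ t≡p        = inj₂ (inj₂ t≡p)
  ... | inj₂ (inj₁ t≡q) = inj₁ t≡q
  ... | inj₂ (inj₂ t≡r) = inj₂ (inj₁ t≡r)

exactly3-at : ∀ {n} {f : Fin n → Bool} {p q r t} → Exactly3 f p q r →
  t ≡ p ⊎ t ≡ q ⊎ t ≡ r → f t ≡ true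
exactly3-at (exactly3 _ (fp , _  , _ ) _) (inj₁ refl)        = fp
exactly3-at (exactly3 _ (_  , fq , _ ) _) (inj₂ (inj₁ refl)) = fq
exactly3-at (exactly3 _ (_  , _  , fr) _) (inj₂ (inj₂ refl)) = fr

remove3 : ∀ {n} → (Fin n → Bool) → Fin n → Fin n → Fin n → Fin n → Bool
remove3 f p q r = remove (remove (remove f p) q) r

count-remove3 : ∀ {n} (f : Fin n → Bool) {p q r} → p ≢ q × p ≢ r × q ≢ r →
  f p ≡ true × f q ≡ true × f r ≡ true → count f ≡ 3 + count (remove3 f p q r)
count-remove3 f {p} {q} {r} (p≢q , p≢r , q≢r) (fp , fq , fr) = begin
  count f                             ≡⟨ count-remove f fp ⟩
  1 + count (remove f p)              ≡⟨ cong suc (count-remove (remove f p) fq′) ⟩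
  2 + count (remove (remove f p) q)   ≡⟨ cong (2 +_) (count-remove (remove (remove f p) q) fr′) ⟩
  3 + count (remove3 f p q r)         ∎
  where
  open ≡-Reasoning
  fq′ : remove f p q ≡ true
  fq′ = trans (remove-other f (λ q≡p → p≢q (sym q≡p))) fq
  fr′ : remove (remove f p) q r ≡ true
  fr′ = trans (remove-other (remove f p) (λ r≡q → q≢r (sym r≡q)))
              (trans (remove-other f (λ r≡p → p≢r (sym r≡p))) fr)

remove3-true : ∀ {n} (f : Fin n → Bool) {p q r v} → remove3 f p q r v ≡ true →
  f v ≡ true × v ≢ p × v ≢ q × v ≢ r
remove3-true f {p} {q} fv =
  let (fv₁ , v≢r) = remove-true (remove (remove f p) q) fv
      (fv₂ , v≢q) = remove-true (remove f p) fv₁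
      (fv₃ , v≢p) = remove-true f fv₂
  in fv₃ , v≢p , v≢q , v≢r

exactly3-count : ∀ {n} {f : Fin n → Bool} {p q r} → Exactly3 f p q r → count f ≡ 3
exactly3-count {f = f} {p} {q} {r} (exactly3 dist holds only) =
  trans (count-remove3 f dist holds) (cong (3 +_) (count-empty _ nothing-left))
  where
  nothing-left : ∀ v → remove3 f p q r v ≡ false
  nothing-left v with remove3 f p q r v in fv
  ... | false = refl
  ... | true with remove3-true f fv
  ... | (fv′ , v≢p , v≢q , v≢r) with only v fv′
  ... | inj₁ v≡p        = ⊥-elim (v≢p v≡p)
  ... | inj₂ (inj₁ v≡q) = ⊥-elim (v≢q v≡q)
  ... | inj₂ (inj₂ v≡r) = ⊥-elim (v≢r v≡r)

count3-complete : ∀ {n} (f : Fin n → Bool) {p q r} → count f ≡ 3 → p ≢ q × p ≢ r × q ≢ r →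
  f p ≡ true × f q ≡ true × f r ≡ true → Exactly3 f p q r
count3-complete f {p} {q} {r} c dist holds = exactly3 dist holds only
  where
  nothing-left : count (remove3 f p q r) ≡ 0
  nothing-left = suc-injective (suc-injective (suc-injective (trans (sym (count-remove3 f dist holds)) c)))
  open ≡-Reasoning
  only : ∀ t → f t ≡ true → t ≡ p ⊎ t ≡ q ⊎ t ≡ r
  only t ft with t ≟ p | t ≟ q | t ≟ r
  ... | yes t≡p | _       | _       = inj₁ t≡p
  ... | no _    | yes t≡q | _       = inj₂ (inj₁ t≡q)
  ... | no _    | no _    | yes t≡r = inj₂ (inj₂ t≡r)
  ... | no t≢p  | no t≢q  | no t≢r  with () ← begin
      true                        ≡⟨ sym ft ⟩
      f t                         ≡⟨ sym (remove-other f t≢p) ⟩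
      remove f p t                ≡⟨ sym (remove-other (remove f p) t≢q) ⟩
      remove (remove f p) q t     ≡⟨ sym (remove-other (remove (remove f p) q) t≢r) ⟩
      remove3 f p q r t           ≡⟨ count-zero (remove3 f p q r) nothing-left t ⟩
      false                       ∎

count3-exactly : ∀ {n} (f : Fin n → Bool) → count f ≡ 3 →
  Σ (Fin n) λ p → Σ (Fin n) λ q → Σ (Fin n) λ r → Exactly3 f p q r
count3-exactly f c =
  let (p , fp)   = count-witness f c
      c₁         = suc-injective (trans (sym (count-remove f fp)) c)
      (q , fq′)  = count-witness (remove f p) c₁
      (fq , q≢p) = remove-true f fq′
      c₂         = suc-injective (trans (sym (count-remove (remove f p) fq′)) c₁)
      (r , fr″)  = count-witness (remove (remove f p) q) c₂
      (fr′ , r≢q) = remove-true (remove f p) fr″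
      (fr , r≢p)  = remove-true f fr′
      dist = (λ p≡q → q≢p (sym p≡q)) , (λ p≡r → r≢p (sym p≡r)) , (λ q≡r → r≢q (sym q≡r))
  in p , q , r , count3-complete f c dist (fp , fq , fr)

Nbrs3 : ∀ {n} → Graph n → Fin n → Fin n → Fin n → Fin n → Set
Nbrs3 G u = Exactly3 (adj G u)

nbrs3-degree : ∀ {n} {G : Graph n} {u p q r} → Nbrs3 G u p q r → degree G u ≡ 3
nbrs3-degree {G = G} {u} nb = trans (degree-count G u) (exactly3-count nb)

neighbours : ∀ {n} {G : Graph n} → InG G → ∀ u →
  Σ (Fin n) λ p → Σ (Fin n) λ q → Σ (Fin n) λ r → Nbrs3 G u p q r
neighbours {G = G} (_ , deg) u = count3-exactly (adj G u) (trans (sym (degree-count G u)) (deg u))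

neighbours-complete : ∀ {n} {G : Graph n} → InG G → ∀ {u p q r} → p ≢ q × p ≢ r × q ≢ r →
  Edge G u p × Edge G u q × Edge G u r → Nbrs3 G u p q r
neighbours-complete {G = G} (_ , deg) {u} =
  count3-complete (adj G u) (trans (sym (degree-count G u)) (deg u))

edge-sym : ∀ {n} {G : Graph n} → IsSimple G → ∀ {a b} → Edge G a b → Edge G b a
edge-sym (symmetric , _) {a} {b} ab = trans (symmetric b a) ab

edge-irrefl : ∀ {n} {G : Graph n} → IsSimple G → ∀ {a b} → Edge G a b → a ≢ b
edge-irrefl (_ , loopless) {a} aa refl with () ← trans (sym aa) (loopless a)

-- Adjacency is transitive on distinct vertices: each component is complete.
EdgeTransitive : ∀ {n} → Graph n → Set
EdgeTransitive {n} G = ∀ (u v w : Fin n) → Edge G u v → Edge G v w → u ≢ w → Edge G u w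

CliqueGraph : ∀ {n} → Graph n → Set
CliqueGraph G = InG G × EdgeTransitive G

-- Every graph of 𝒦_n is a clique graph: two vertices joined by a path lie in
-- one K₄-component, whose vertices are pairwise adjacent.
inK-clique : ∀ {n} {G : Graph n} → InK G → CliqueGraph G
inK-clique {G = G} (inG , components) = inG , transitive
  where
  transitive : EdgeTransitive G
  transitive u v w uv vw u≢w with components u
  ... | (a , b , c , d , _ , reach , (ab , ac , ad , bc , bd , cd)) =
    k4-edge (Equivalence.to (reach u) ε) (Equivalence.to (reach w) (uv ◅ vw ◅ ε)) u≢w
    where
    s = edge-sym (proj₁ inG)
    k4-edge : ∀ {x y} → (x ≡ a ⊎ x ≡ b ⊎ x ≡ c ⊎ x ≡ d) →
      (y ≡ a ⊎ y ≡ b ⊎ y ≡ c ⊎ y ≡ d) → x ≢ y → Edge G x y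
    k4-edge (inj₁ refl)               (inj₂ (inj₁ refl))        _ = ab
    k4-edge (inj₁ refl)               (inj₂ (inj₂ (inj₁ refl))) _ = ac
    k4-edge (inj₁ refl)               (inj₂ (inj₂ (inj₂ refl))) _ = ad
    k4-edge (inj₂ (inj₁ refl))        (inj₁ refl)               _ = s ab
    k4-edge (inj₂ (inj₁ refl))        (inj₂ (inj₂ (inj₁ refl))) _ = bc
    k4-edge (inj₂ (inj₁ refl))        (inj₂ (inj₂ (inj₂ refl))) _ = bd
    k4-edge (inj₂ (inj₂ (inj₁ refl))) (inj₁ refl)               _ = s ac
    k4-edge (inj₂ (inj₂ (inj₁ refl))) (inj₂ (inj₁ refl))        _ = s bc
    k4-edge (inj₂ (inj₂ (inj₁ refl))) (inj₂ (inj₂ (inj₂ refl))) _ = cd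
    k4-edge (inj₂ (inj₂ (inj₂ refl))) (inj₁ refl)               _ = s ad
    k4-edge (inj₂ (inj₂ (inj₂ refl))) (inj₂ (inj₁ refl))        _ = s bd
    k4-edge (inj₂ (inj₂ (inj₂ refl))) (inj₂ (inj₂ (inj₁ refl))) _ = s cd
    k4-edge {x} (inj₁ refl)           (inj₁ refl)               x≢x = ⊥-elim (x≢x refl)
    k4-edge {x} (inj₂ (inj₁ refl))    (inj₂ (inj₁ refl))        x≢x = ⊥-elim (x≢x refl)
    k4-edge {x} (inj₂ (inj₂ (inj₁ refl))) (inj₂ (inj₂ (inj₁ refl))) x≢x = ⊥-elim (x≢x refl)
    k4-edge {x} (inj₂ (inj₂ (inj₂ refl))) (inj₂ (inj₂ (inj₂ refl))) x≢x = ⊥-elim (x≢x refl)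

Near : ∀ {n} → Graph n → Fin n → Fin n → Set
Near G u x = x ≡ u ⊎ Edge G u x

module ClosedNeighbourhoods {n} {G : Graph n} (simple : IsSimple G) (transitive : EdgeTransitive G) where

  near-closed : ∀ {u x y} → Near G u x → Edge G x y → Near G u y
  near-closed (inj₁ refl) xy = inj₂ xy
  near-closed {u} {y = y} (inj₂ ux) xy with y ≟ u
  ... | yes y≡u = inj₁ y≡u
  ... | no  y≢u = inj₂ (transitive u _ y ux xy (λ u≡y → y≢u (sym u≡y)))

  near-adjacent : ∀ {u x y} → Near G u x → Near G u y → x ≢ y → Edge G x y
  near-adjacent (inj₁ refl) (inj₁ refl) x≢y = ⊥-elim (x≢y refl)
  near-adjacent (inj₁ refl) (inj₂ uy)   _   = uy
  near-adjacent (inj₂ ux)   (inj₁ refl) _   = edge-sym simple ux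
  near-adjacent (inj₂ ux)   (inj₂ uy)   x≢y = transitive _ _ _ (edge-sym simple ux) uy x≢y

  near-disjoint : ∀ {u h x} → u ≢ h → ¬ Edge G u h → Near G u x → Near G h x → ⊥
  near-disjoint {u} {h} {x} u≢h u≁h ux hx = h-not-near (h-near hx)
    where
    h-near : Near G h x → Near G u h
    h-near (inj₁ refl) = ux
    h-near (inj₂ hx′)  = near-closed ux (edge-sym simple hx′)
    h-not-near : ¬ Near G u h
    h-not-near (inj₁ h≡u) = u≢h (sym h≡u)
    h-not-near (inj₂ uh)  = u≁h uh

RowsAgree : ∀ {n} → Graph n → Graph n → Fin n → Set
RowsAgree G H v = ∀ w → adj G v w ≡ adj H v w

rows-agree-spread : ∀ {n} {G H : Graph n} → CliqueGraph G → CliqueGraph H →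
  ∀ {w x} → RowsAgree G H w → Edge G w x → RowsAgree G H x
rows-agree-spread {n} {G} {H} ((simpleG , _) , transG) ((simpleH , _) , transH) {w} {x} agree wx t =
  ⇔→≡ {z = true} (mk⇔ (one-way simpleG transG simpleH transH agree wx)
                       (one-way simpleH transH simpleG transG (λ t → sym (agree t)) Hwx))
  where
  Hwx : Edge H w x
  Hwx = trans (sym (agree x)) wx
  -- A neighbour t of x is w itself or, by transitivity, a neighbour of w.
  one-way : ∀ {A B : Graph n} → IsSimple A → EdgeTransitive A → IsSimple B → EdgeTransitive B →
    RowsAgree A B w → Edge A w x → Edge A x t → Edge B x t
  one-way {A} {B} simpleA transA simpleB transB agreeAB Awx xt with t ≟ w
  ... | yes refl = edge-sym simpleB (trans (sym (agreeAB x)) Awx)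
  ... | no  t≢w  = transB x w t (edge-sym simpleB Bwx) Bwt (edge-irrefl simpleA xt)
    where
    Bwx : Edge B w x
    Bwx = trans (sym (agreeAB x)) Awx
    Bwt : Edge B w t
    Bwt = trans (sym (agreeAB t)) (transA w x t Awx xt (λ w≡t → t≢w (sym w≡t)))

same-neighbours : ∀ {n} {G H : Graph n} {u p q r} → Nbrs3 G u p q r → Nbrs3 H u p q r → RowsAgree G H u
same-neighbours nbrs-G nbrs-H t =
  ⇔→≡ {z = true} (mk⇔ (exactly3-at nbrs-H ∘ Exactly3.only nbrs-G t)
                       (exactly3-at nbrs-G ∘ Exactly3.only nbrs-H t))

-- Planting a pattern graph M on m vertices into G along an injection e:
-- the edges among the image of e are replaced by those of M, the rest of G
-- is kept.  When the image of e is a union of components of G, regularity,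
-- transitivity and moves of patterns carry over to the planted graphs.
module Planting {n m : ℕ} (G : Graph n) (e : Fin m → Fin n)
                (e-injective : ∀ {j k} → e j ≡ e k → j ≡ k) where

  Outside : Fin n → Set
  Outside a = ∀ j → e j ≢ a

  Located : Fin n → Set
  Located a = (Σ (Fin m) λ j → e j ≡ a) ⊎ Outside a

  locate : ∀ a → Located a
  locate a with any? (λ j → e j ≟ a)
  ... | yes found = inj₁ found
  ... | no  none  = inj₂ (λ j ej≡a → none (j , ej≡a))

  image-distinct : ∀ {j k} → j ≢ k → e j ≢ e k
  image-distinct j≢k = j≢k ∘ e-injective

  record Planted (M : Graph m) (X : Graph n) : Set where
    field
      inside  : ∀ j k → adj X (e j) (e k) ≡ adj M j k
      outside : ∀ a b → Outside a ⊎ Outside b → adj X a b ≡ adj G a b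
  open Planted

  plant : Graph m → Graph n
  plant M = mkGraph λ a b → planted-adj a b (locate a) (locate b)
    where
    planted-adj : ∀ a b → Located a → Located b → Bool
    planted-adj a b (inj₁ (j , _)) (inj₁ (k , _)) = adj M j k
    planted-adj a b _              _              = adj G a b

  plant-planted : ∀ M → Planted M (plant M)
  plant-planted M = record { inside = inside′ ; outside = outside′ }
    where
    inside′ : ∀ j k → adj (plant M) (e j) (e k) ≡ adj M j k
    inside′ j k with locate (e j) | locate (e k)
    ... | inj₁ (j′ , ej′≡ej) | inj₁ (k′ , ek′≡ek)
      rewrite e-injective ej′≡ej | e-injective ek′≡ek = refl
    ... | inj₁ _ | inj₂ out = ⊥-elim (out k refl)
    ... | inj₂ out | _      = ⊥-elim (out j refl)
    outside′ : ∀ a b → Outside a ⊎ Outside b → adj (plant M) a b ≡ adj G a b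
    outside′ a b out with locate a | locate b | out
    ... | inj₁ (j , ej≡a) | inj₁ _ | inj₁ out-a = ⊥-elim (out-a j ej≡a)
    ... | inj₁ _ | inj₁ (k , ek≡b) | inj₂ out-b = ⊥-elim (out-b k ek≡b)
    ... | inj₁ _ | inj₂ _ | _ = refl
    ... | inj₂ _ | _      | _ = refl

  self-planted : ∀ {M} → (∀ j k → adj G (e j) (e k) ≡ adj M j k) → Planted M G
  self-planted agree = record { inside = agree ; outside = λ _ _ _ → refl }

  Isolated : Graph n → Set
  Isolated X = ∀ j b → Outside b → ¬ Edge X (e j) b

  planted-isolated : ∀ {M X} → Isolated G → Planted M X → Isolated X
  planted-isolated isolated P j b out Xjb =
    isolated j b out (trans (sym (outside P (e j) b (inj₂ out))) Xjb)

  planted-entering : ∀ {M X} → (∀ a b → adj G a b ≡ adj G b a) → Isolated G → Planted M X →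
    ∀ j a → Outside a → ¬ Edge X a (e j)
  planted-entering symG isolated P j a out aj =
    isolated j a out (trans (symG (e j) a) (trans (sym (outside P a (e j) (inj₁ out))) aj))

  planted-simple : ∀ {M X} → IsSimple G → IsSimple M → Planted M X → IsSimple X
  planted-simple {M} {X} (symG , looplessG) (symM , looplessM) P = symmetric , loopless
    where
    symmetric : ∀ a b → adj X a b ≡ adj X b a
    symmetric a b with locate a | locate b
    ... | inj₁ (j , refl) | inj₁ (k , refl) =
      trans (inside P j k) (trans (symM j k) (sym (inside P k j)))
    ... | inj₂ out | _ =
      trans (outside P a b (inj₁ out)) (trans (symG a b) (sym (outside P b a (inj₂ out))))
    ... | inj₁ _ | inj₂ out =
      trans (outside P a b (inj₂ out)) (trans (symG a b) (sym (outside P b a (inj₁ out))))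
    loopless : ∀ a → adj X a a ≡ false
    loopless a with locate a
    ... | inj₁ (j , refl) = trans (inside P j j) (looplessM j)
    ... | inj₂ out        = trans (outside P a a (inj₁ out)) (looplessG a)

  planted-inG : ∀ {M X} → InG G → Isolated G → InG M → Planted M X → InG X
  planted-inG {M} {X} (simpleG , regularG) isolated inM@(simpleM , _) P =
    planted-simple simpleG simpleM P , regular
    where
    regular : ∀ a → degree X a ≡ 3
    regular a with locate a
    ... | inj₂ out = begin
      degree X a       ≡⟨ degree-count X a ⟩
      count (adj X a)  ≡⟨ count-cong (λ b → outside P a b (inj₁ out)) ⟩
      count (adj G a)  ≡⟨ sym (degree-count G a) ⟩
      degree G a       ≡⟨ regularG a ⟩
      3                ∎
      where open ≡-Reasoning
    ... | inj₁ (j , refl) with neighbours inM j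
    ... | (p , q , r , exactly3 (p≢q , p≢r , q≢r) (jp , jq , jr) only) =
      nbrs3-degree {G = X} {u = e j}
        (exactly3 (image-distinct p≢q , image-distinct p≢r , image-distinct q≢r)
                  (trans (inside P j p) jp , trans (inside P j q) jq , trans (inside P j r) jr)
                  only-image)
      where
      only-image : ∀ t → Edge X (e j) t → t ≡ e p ⊎ t ≡ e q ⊎ t ≡ e r
      only-image t jt with locate t
      ... | inj₂ out        = ⊥-elim (planted-isolated isolated P j t out jt)
      ... | inj₁ (k , refl) =
        Sum.map (cong e) (Sum.map (cong e) (cong e)) (only k (trans (sym (inside P j k)) jt))

  planted-transitive : ∀ {M X} → IsSimple G → EdgeTransitive G → Isolated G →
    EdgeTransitive M → Planted M X → EdgeTransitive X
  planted-transitive {M} {X} (symG , _) transG isolated transM P u v w uv vw u≢w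
    with locate u | locate v | locate w
  ... | inj₁ (i , refl) | inj₁ (j , refl) | inj₁ (k , refl) =
    trans (inside P i k)
      (transM i j k (trans (sym (inside P i j)) uv) (trans (sym (inside P j k)) vw) (u≢w ∘ cong e))
  ... | inj₂ ou | inj₂ ov | inj₂ ow =
    trans (outside P u w (inj₁ ou))
      (transG u v w (trans (sym (outside P u v (inj₁ ou))) uv) (trans (sym (outside P v w (inj₁ ov))) vw) u≢w)
  ... | inj₁ (i , refl) | inj₁ (j , refl) | inj₂ ow = ⊥-elim (planted-isolated isolated P j w ow vw)
  ... | inj₁ (i , refl) | inj₂ ov | _               = ⊥-elim (planted-isolated isolated P i v ov uv)
  ... | inj₂ ou | inj₁ (j , refl) | _               = ⊥-elim (planted-entering symG isolated P j u ou uv)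
  ... | inj₂ ou | inj₂ ov | inj₁ (k , refl)         = ⊥-elim (planted-entering symG isolated P k v ov vw)

  edge-image : ∀ {M X} → Planted M X → ∀ {j k} → Edge X (e j) (e k) ⇔ Edge M j k
  edge-image P {j} {k} = mk⇔ (trans (sym (inside P j k))) (trans (inside P j k))

  pair-image : ∀ {j k x y} → SamePair (e j) (e k) (e x) (e y) ⇔ SamePair j k x y
  pair-image = mk⇔ (Sum.map (Prod.map e-injective e-injective) (Prod.map e-injective e-injective))
                   (Sum.map (Prod.map (cong e) (cong e)) (Prod.map (cong e) (cong e)))

  outside-pair : ∀ {a b} → Outside a ⊎ Outside b → ∀ x y → ¬ SamePair a b (e x) (e y)
  outside-pair (inj₁ out-a) x y (inj₁ (a≡x , _)) = out-a x (sym a≡x)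
  outside-pair (inj₁ out-a) x y (inj₂ (a≡y , _)) = out-a y (sym a≡y)
  outside-pair (inj₂ out-b) x y (inj₁ (_ , b≡y)) = out-b y (sym b≡y)
  outside-pair (inj₂ out-b) x y (inj₂ (_ , b≡x)) = out-b x (sym b≡x)

  switch-outside : ∀ {M M′ X Y} → Planted M X → Planted M′ Y → ∀ {a b} → Outside a ⊎ Outside b →
    ∀ p q r s p′ q′ r′ s′ →
    Edge Y a b ⇔ ((Edge X a b × ¬ SamePair a b (e p) (e q) × ¬ SamePair a b (e r) (e s))
                  ⊎ SamePair a b (e p′) (e q′) ⊎ SamePair a b (e r′) (e s′))
  switch-outside {X = X} {Y} P P′ {a} {b} out p q r s p′ q′ r′ s′ = mk⇔ forward backward
    where
    same : adj Y a b ≡ adj X a b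
    same = trans (outside P′ a b out) (sym (outside P a b out))
    forward : Edge Y a b → _
    forward Yab = inj₁ (trans (sym same) Yab , outside-pair out p q , outside-pair out r s)
    backward : _ → Edge Y a b
    backward (inj₁ (Xab , _))  = trans same Xab
    backward (inj₂ (inj₁ sp′)) = ⊥-elim (outside-pair out p′ q′ sp′)
    backward (inj₂ (inj₂ sp′)) = ⊥-elim (outside-pair out r′ s′ sp′)

  planted-switch : ∀ {M M′ X Y} → Planted M X → Planted M′ Y → ∀ {p q r s p′ q′ r′ s′} →
    Switch M M′ p q r s p′ q′ r′ s′ → Switch X Y (e p) (e q) (e r) (e s) (e p′) (e q′) (e r′) (e s′)
  planted-switch P P′ {p} {q} {r} {s} {p′} {q′} {r′} {s′} switch a b
    with locate a | locate b
  ... | inj₁ (j , refl) | inj₁ (k , refl) =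
    ⇔-trans (edge-image P′) (⇔-trans (switch j k) (⇔-sym
      ((edge-image P ×-⇔ ¬-cong-⇔ pair-image ×-⇔ ¬-cong-⇔ pair-image) ⊎-⇔ pair-image ⊎-⇔ pair-image)))
  ... | inj₂ out | _      = switch-outside P P′ (inj₁ out) p q r s p′ q′ r′ s′
  ... | inj₁ _ | inj₂ out = switch-outside P P′ (inj₂ out) p q r s p′ q′ r′ s′

  module _ {M M′ X Y} (P : Planted M X) (P′ : Planted M′ Y) where
    private
      ≠ : ∀ {j k} → j ≢ k → e j ≢ e k
      ≠ = image-distinct
      E : ∀ {j k} → Edge M j k → Edge X (e j) (e k)
      E = Equivalence.from (edge-image P)
      ≁ : ∀ {j k} → ¬ Edge M j k → ¬ Edge X (e j) (e k)
      ≁ j≁k = j≁k ∘ Equivalence.to (edge-image P)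

    planted-make : Make M M′ → Make X Y
    planted-make (y , x , v , w , z , (d₁ , d₂ , d₃ , d₄ , d₅ , d₆ , d₇ , d₈ , d₉ , d₁₀) ,
                  yx , xv , vw , wz , x≁w , y≁z , switch) =
      e y , e x , e v , e w , e z ,
      (≠ d₁ , ≠ d₂ , ≠ d₃ , ≠ d₄ , ≠ d₅ , ≠ d₆ , ≠ d₇ , ≠ d₈ , ≠ d₉ , ≠ d₁₀) ,
      E yx , E xv , E vw , E wz , ≁ x≁w , ≁ y≁z , planted-switch P P′ switch

    planted-break : Break M M′ → Break X Y
    planted-break (v , x , w , y , z , (d₁ , d₂ , d₃ , d₄) , vx , xw , wv , yz ,
                   (d₅ , d₆ , d₇ , d₈ , d₉ , d₁₀) , x≁y , w≁z , switch) =
      e v , e x , e w , e y , e z , (≠ d₁ , ≠ d₂ , ≠ d₃ , ≠ d₄) ,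
      E vx , E xw , E wv , E yz , (≠ d₅ , ≠ d₆ , ≠ d₇ , ≠ d₈ , ≠ d₉ , ≠ d₁₀) ,
      ≁ x≁y , ≁ w≁z , planted-switch P P′ switch

  planted-move : ∀ {M M′ X Y} → Planted M X → Planted M′ Y → Move M M′ → Move X Y
  planted-move P P′ = Sum.map (planted-make P P′) (planted-break P P′)

  planted-adjacent : ∀ {M M′ X Y} → InG G → Isolated G → Planted M X → Planted M′ Y →
    Adj* M M′ → Adj* X Y
  planted-adjacent inG isolated P P′ (inM , inM′ , moves) =
    planted-inG inG isolated inM P , planted-inG inG isolated inM′ P′ ,
    Sum.map (planted-move P P′) (planted-move P′ P) moves

_⇔-dec_ : ∀ {A B : Set} → Dec A → Dec B → Dec (A ⇔ B)
a? ⇔-dec b? = map′ (λ (to , from) → mk⇔ to from) (λ a⇔b → Equivalence.to a⇔b , Equivalence.from a⇔b)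
                   ((a? →-dec b?) ×-dec (b? →-dec a?))

module _ {m : ℕ} where

  edge? : (M : Graph m) → ∀ a b → Dec (Edge M a b)
  edge? M a b = adj M a b ≟ᵇ true

  inG? : (M : Graph m) → Dec (InG M)
  inG? M = ((all? λ a → all? λ b → adj M a b ≟ᵇ adj M b a) ×-dec (all? λ a → adj M a a ≟ᵇ false))
           ×-dec (all? λ a → degree M a ≟ℕ 3)

  transitive? : (M : Graph m) → Dec (EdgeTransitive M)
  transitive? M = all? λ u → all? λ v → all? λ w →
    edge? M u v →-dec edge? M v w →-dec ¬? (u ≟ w) →-dec edge? M u w

  samePair? : (a b x y : Fin m) → Dec (SamePair a b x y)
  samePair? a b x y = (a ≟ x ×-dec b ≟ y) ⊎-dec (a ≟ y ×-dec b ≟ x)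

  switch? : (M M′ : Graph m) → ∀ p q r s p′ q′ r′ s′ → Dec (Switch M M′ p q r s p′ q′ r′ s′)
  switch? M M′ p q r s p′ q′ r′ s′ = all? λ a → all? λ b →
    edge? M′ a b ⇔-dec ((edge? M a b ×-dec ¬? (samePair? a b p q) ×-dec ¬? (samePair? a b r s))
                        ⊎-dec samePair? a b p′ q′ ⊎-dec samePair? a b r′ s′)

-- The swap patterns on 8 vertices.  Vertices 0–3 and 4–7 start as two K₄'s;
-- one break and two makes exchange vertices 1 and 4, leaving the K₄'s
-- {0,2,3,4} and {1,5,6,7}.

twoK4-adj : Fin 4 ⊎ Fin 4 → Fin 4 ⊎ Fin 4 → Bool
twoK4-adj (inj₁ i) (inj₁ j) = not (does (i ≟ j))
twoK4-adj (inj₂ i) (inj₂ j) = not (does (i ≟ j))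
twoK4-adj _        _        = false

twoK4 : Graph 8
twoK4 = mkGraph λ a b → twoK4-adj (splitAt 4 a) (splitAt 4 b)

fromEdges : List (ℕ × ℕ) → Graph 8
fromEdges es = mkGraph λ a b → any (joins a b) es
  where
  joins : Fin 8 → Fin 8 → ℕ × ℕ → Bool
  joins a b (x , y) = ((toℕ a ≡ᵇ x) ∧ (toℕ b ≡ᵇ y)) ∨ ((toℕ a ≡ᵇ y) ∧ (toℕ b ≡ᵇ x))

afterBreak afterMake swapped : Graph 8
afterBreak = fromEdges ((0 , 1) ∷ (0 , 2) ∷ (0 , 3) ∷ (1 , 3) ∷ (2 , 3) ∷ (1 , 5) ∷
                        (2 , 4) ∷ (4 , 6) ∷ (4 , 7) ∷ (5 , 6) ∷ (5 , 7) ∷ (6 , 7) ∷ [])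
afterMake  = fromEdges ((0 , 2) ∷ (0 , 3) ∷ (0 , 4) ∷ (1 , 3) ∷ (2 , 3) ∷ (1 , 5) ∷
                        (2 , 4) ∷ (1 , 6) ∷ (4 , 7) ∷ (5 , 6) ∷ (5 , 7) ∷ (6 , 7) ∷ [])
swapped    = fromEdges ((0 , 2) ∷ (0 , 3) ∷ (0 , 4) ∷ (2 , 3) ∷ (2 , 4) ∷ (3 , 4) ∷
                        (1 , 5) ∷ (1 , 6) ∷ (1 , 7) ∷ (5 , 6) ∷ (5 , 7) ∷ (6 , 7) ∷ [])

swapped-transitive : EdgeTransitive swapped
swapped-transitive = from-yes (transitive? swapped)

-- break(0 1 2, 5 4): the triangle 012 and the edge 54 become the edges 15, 24.
swap-break : Adj* twoK4 afterBreak
swap-break = from-yes (inG? twoK4) , from-yes (inG? afterBreak) , inj₁ (inj₂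
  (# 0 , # 1 , # 2 , # 5 , # 4 , ((λ ()) , (λ ()) , (λ ()) , (λ ())) ,
   refl , refl , refl , refl , ((λ ()) , (λ ()) , (λ ()) , (λ ()) , (λ ()) , (λ ())) , (λ ()) , (λ ()) ,
   from-yes (switch? twoK4 afterBreak (# 1) (# 2) (# 5) (# 4) (# 1) (# 5) (# 2) (# 4))))

-- make(1 0 2 4 6): the edges 10, 46 become 04, 16.
swap-make₁ : Adj* afterBreak afterMake
swap-make₁ = from-yes (inG? afterBreak) , from-yes (inG? afterMake) , inj₁ (inj₁
  (# 1 , # 0 , # 2 , # 4 , # 6 ,
   ((λ ()) , (λ ()) , (λ ()) , (λ ()) , (λ ()) , (λ ()) , (λ ()) , (λ ()) , (λ ()) , (λ ())) ,
   refl , refl , refl , refl , (λ ()) , (λ ()) ,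
   from-yes (switch? afterBreak afterMake (# 0) (# 1) (# 4) (# 6) (# 0) (# 4) (# 1) (# 6))))

-- make(1 3 0 4 7): the edges 13, 47 become 34, 17.
swap-make₂ : Adj* afterMake swapped
swap-make₂ = from-yes (inG? afterMake) , from-yes (inG? swapped) , inj₁ (inj₁
  (# 1 , # 3 , # 0 , # 4 , # 7 ,
   ((λ ()) , (λ ()) , (λ ()) , (λ ()) , (λ ()) , (λ ()) , (λ ()) , (λ ()) , (λ ()) , (λ ())) ,
   refl , refl , refl , refl , (λ ()) , (λ ()) ,
   from-yes (switch? afterMake swapped (# 3) (# 1) (# 4) (# 7) (# 3) (# 4) (# 1) (# 7))))

closed-nbhd : ∀ {n} → Fin n → Fin n → Fin n → Fin n → Fin 4 → Fin n
closed-nbhd u p q r = lookup (u ∷ p ∷ q ∷ r ∷ [])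

Swapped : ∀ {n} → Graph n → (u g₁ g₂ h : Fin n) → Set
Swapped {n} G u g₁ g₂ h = Σ (Graph n) λ G′ → Star Adj* G G′ × CliqueGraph G′ ×
  (Edge G′ u h × Edge G′ u g₁ × Edge G′ u g₂) ×
  (∀ a → ¬ Near G u a → ¬ Near G h a → RowsAgree G′ G a)

module Swapping {n} {G : Graph n} (clique : CliqueGraph G) where

  private
    simple : IsSimple G
    simple = proj₁ (proj₁ clique)
    transitive : EdgeTransitive G
    transitive = proj₂ clique
  open ClosedNeighbourhoods simple transitive

  module _ {u p q r} (nbrs : Nbrs3 G u p q r) where
    open Exactly3 nbrs

    nbhd-near : ∀ i → Near G u (closed-nbhd u p q r i)
    nbhd-near zero                   = inj₁ refl
    nbhd-near (suc zero)             = inj₂ (proj₁ holds)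
    nbhd-near (suc (suc zero))       = inj₂ (proj₁ (proj₂ holds))
    nbhd-near (suc (suc (suc zero))) = inj₂ (proj₂ (proj₂ holds))

    nbhd-onto : ∀ {x} → Near G u x → Σ (Fin 4) λ i → closed-nbhd u p q r i ≡ x
    nbhd-onto (inj₁ refl) = # 0 , refl
    nbhd-onto {x} (inj₂ ux) with only x ux
    ... | inj₁ refl        = # 1 , refl
    ... | inj₂ (inj₁ refl) = # 2 , refl
    ... | inj₂ (inj₂ refl) = # 3 , refl

    nbhd-injective : ∀ {i j} → closed-nbhd u p q r i ≡ closed-nbhd u p q r j → i ≡ j
    nbhd-injective with distinct | holds
    ... | (p≢q , p≢r , q≢r) | (up , uq , ur) = lookup-injective
      ((irr up ∷ irr uq ∷ irr ur ∷ []) ∷ (p≢q ∷ p≢r ∷ []) ∷ (q≢r ∷ []) ∷ [] ∷ []) _ _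
      where
      irr : ∀ {x} → Edge G u x → u ≢ x
      irr = edge-irrefl simple

    nbhd-adj : ∀ i j → adj G (closed-nbhd u p q r i) (closed-nbhd u p q r j) ≡ not (does (i ≟ j))
    nbhd-adj i j with i ≟ j
    ... | yes refl = proj₂ simple _
    ... | no  i≢j  = near-adjacent (nbhd-near i) (nbhd-near j) (i≢j ∘ nbhd-injective)

  -- Two K₄-components, N[u] and N[h], listed with the vertices g of N[u] and h of
  -- N[h] in the positions 1 and 4 that the swap patterns exchange.
  module _ {u g g₁ g₂ h c₁ c₂ c₃} (nbrs-u : Nbrs3 G u g g₁ g₂) (nbrs-h : Nbrs3 G h c₁ c₂ c₃)
           (u≢h : u ≢ h) (u≁h : ¬ Edge G u h) where

    block : Fin 4 ⊎ Fin 4 → Fin n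
    block = [ closed-nbhd u g g₁ g₂ , closed-nbhd h c₁ c₂ c₃ ]′

    centre : Fin 4 ⊎ Fin 4 → Fin n
    centre = [ const u , const h ]′

    embed : Fin 8 → Fin n
    embed j = block (splitAt 4 j)

    block-near : ∀ s → Near G (centre s) (block s)
    block-near (inj₁ i) = nbhd-near nbrs-u i
    block-near (inj₂ i) = nbhd-near nbrs-h i

    block-onto : ∀ s {x} → Near G (centre s) x → Σ (Fin 4 ⊎ Fin 4) λ t → block t ≡ x
    block-onto (inj₁ _) near = let (i , eq) = nbhd-onto nbrs-u near in inj₁ i , eq
    block-onto (inj₂ _) near = let (i , eq) = nbhd-onto nbrs-h near in inj₂ i , eq

    apart : ∀ {x} → Near G u x → ¬ Near G h x
    apart = near-disjoint u≢h u≁h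

    block-injective : ∀ {s t} → block s ≡ block t → s ≡ t
    block-injective {inj₁ i} {inj₁ j} eq = cong inj₁ (nbhd-injective nbrs-u eq)
    block-injective {inj₂ i} {inj₂ j} eq = cong inj₂ (nbhd-injective nbrs-h eq)
    block-injective {inj₁ i} {inj₂ j} eq =
      ⊥-elim (apart (nbhd-near nbrs-u i) (subst (Near G h) (sym eq) (nbhd-near nbrs-h j)))
    block-injective {inj₂ i} {inj₁ j} eq =
      ⊥-elim (apart (nbhd-near nbrs-u j) (subst (Near G h) eq (nbhd-near nbrs-h i)))

    embed-injective : ∀ {j k} → embed j ≡ embed k → j ≡ k
    embed-injective {j} {k} eq = begin
      j                        ≡⟨ sym (join-splitAt 4 4 j) ⟩
      join 4 4 (splitAt 4 j)   ≡⟨ cong (join 4 4) (block-injective {splitAt 4 j} {splitAt 4 k} eq) ⟩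
      join 4 4 (splitAt 4 k)   ≡⟨ join-splitAt 4 4 k ⟩
      k                        ∎
      where open ≡-Reasoning

    block-adj : ∀ s t → adj G (block s) (block t) ≡ twoK4-adj s t
    block-adj (inj₁ i) (inj₁ j) = nbhd-adj nbrs-u i j
    block-adj (inj₂ i) (inj₂ j) = nbhd-adj nbrs-h i j
    block-adj (inj₁ i) (inj₂ j) = ¬-not λ ij →
      apart (near-closed (nbhd-near nbrs-u i) ij) (nbhd-near nbrs-h j)
    block-adj (inj₂ i) (inj₁ j) = ¬-not λ ij →
      apart (near-closed (nbhd-near nbrs-u j) (edge-sym simple ij)) (nbhd-near nbrs-h i)

    open Planting G embed embed-injective

    isolated : Isolated G
    isolated j b out jb with block-onto (splitAt 4 j) (near-closed (block-near (splitAt 4 j)) jb)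
    ... | (t , eq) = out (join 4 4 t) (trans (cong block (splitAt-join 4 4 t)) eq)

    far-outside : ∀ {a} → ¬ Near G u a → ¬ Near G h a → Outside a
    far-outside {a} far-u far-h j eq = far (splitAt 4 j) (subst (Near G _) eq (block-near (splitAt 4 j)))
      where
      far : ∀ s → ¬ Near G (centre s) a
      far (inj₁ _) = far-u
      far (inj₂ _) = far-h

    -- Swapping g and h by planting the path twoK4 → afterBreak → afterMake → swapped;
    -- in swapped the vertex 0 (u) is adjacent to 4 (h), 2 (g₁) and 3 (g₂).
    swap : Swapped G u g₁ g₂ h
    swap = plant swapped , (step₁ ◅ step₂ ◅ step₃ ◅ ε) ,
           (proj₁ (proj₂ step₃) , planted-transitive simple transitive isolated swapped-transitive P₃) ,
           (inside P₃ (# 0) (# 4) , inside P₃ (# 0) (# 2) , inside P₃ (# 0) (# 3)) ,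
           λ a far-u far-h b → outside P₃ a b (inj₁ (far-outside far-u far-h))
      where
      open Planted
      P₀ : Planted twoK4 G
      P₀ = self-planted (λ j k → block-adj (splitAt 4 j) (splitAt 4 k))
      P₁ : Planted afterBreak (plant afterBreak)
      P₁ = plant-planted afterBreak
      P₂ : Planted afterMake (plant afterMake)
      P₂ = plant-planted afterMake
      P₃ : Planted swapped (plant swapped)
      P₃ = plant-planted swapped
      step₁ : Adj* G (plant afterBreak)
      step₁ = planted-adjacent (proj₁ clique) isolated P₀ P₁ swap-break
      step₂ : Adj* (plant afterBreak) (plant afterMake)
      step₂ = planted-adjacent (proj₁ clique) isolated P₁ P₂ swap-make₁
      step₃ : Adj* (plant afterMake) (plant swapped)
      step₃ = planted-adjacent (proj₁ clique) isolated P₂ P₃ swap-make₂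

module Reconfiguration {n} (H : Graph n) (cliqueH : CliqueGraph H) where

  private
    inH : InG H
    inH = proj₁ cliqueH
    simpleH : IsSimple H
    simpleH = proj₁ inH

  FixedBelow : ℕ → Graph n → Set
  FixedBelow k G = ∀ v → toℕ v < k → RowsAgree G H v

  Reachable : ℕ → Graph n → Set
  Reachable k G = Σ (Graph n) λ G′ → Star Adj* G G′ × CliqueGraph G′ × FixedBelow k G′

  -- A vertex already agreeing with H is not in the component of an endpoint u
  -- of an H-edge uh missing from G, since agreement spreads along components.
  fixed-far : ∀ {G} → CliqueGraph G → ∀ {u h v} → Edge H u h → ¬ Edge G u h →
    RowsAgree G H v → ¬ Near G u v
  fixed-far clique {h = h} uh u≁h agree (inj₁ refl) = u≁h (trans (agree h) uh)
  fixed-far clique {h = h} uh u≁h agree (inj₂ uv) =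
    u≁h (trans (rows-agree-spread clique cliqueH agree (edge-sym (proj₁ (proj₁ clique)) uv) h) uh)

  stray-neighbour : ∀ {G u h} → InG G → Edge H u h → ¬ Edge G u h →
    Σ (Fin n) λ g → Σ (Fin n) λ g₁ → Σ (Fin n) λ g₂ → Nbrs3 G u g g₁ g₂ × ¬ Edge H u g
  stray-neighbour {G} {u} {h} inG uh u≁h with neighbours inG u
  ... | (p , q , r , nbrs) with adj H u p in Hp | adj H u q in Hq | adj H u r in Hr
  ... | false | _     | _     = p , q , r , nbrs , not-¬ Hp
  ... | true  | false | _     = q , r , p , exactly3-rotate nbrs , not-¬ Hq
  ... | true  | true  | false = r , p , q , exactly3-rotate (exactly3-rotate nbrs) , not-¬ Hr
  ... | true  | true  | true  = ⊥-elim (u≁h (exactly3-at nbrs h-among))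
    where
    -- p, q, r would be all the H-neighbours of u, h among them.
    h-among : h ≡ p ⊎ h ≡ q ⊎ h ≡ r
    h-among = Exactly3.only (neighbours-complete inH (Exactly3.distinct nbrs) (Hp , Hq , Hr)) h uh

  Keeps : Fin n → Graph n → Graph n → Set
  Keeps u G G′ = ∀ t → Edge H u t → Edge G u t → Edge G′ u t

  EdgeInserted : ℕ → Graph n → Fin n → Fin n → Set
  EdgeInserted k G u h =
    Σ (Graph n) λ G′ → Star Adj* G G′ × CliqueGraph G′ × FixedBelow k G′ × Edge G′ u h × Keeps u G G′

  insert-edge : ∀ {k G} → CliqueGraph G → FixedBelow k G → ∀ {u h} → Edge H u h → EdgeInserted k G u h
  insert-edge {k} {G} clique fixed {u} {h} uh with adj G u h in Guh
  ... | true  = G , ε , clique , fixed , Guh , λ _ _ ut → ut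
  ... | false with stray-neighbour (proj₁ clique) uh (not-¬ Guh)
  ... | (g , g₁ , g₂ , nbrs-u , u≁Hg) with neighbours (proj₁ clique) h
  ... | (c₁ , c₂ , c₃ , nbrs-h) =
    after-swap (Swapping.swap clique nbrs-u nbrs-h (edge-irrefl simpleH uh) u≁h)
    where
    u≁h : ¬ Edge G u h
    u≁h = not-¬ Guh
    after-swap : Swapped G u g₁ g₂ h → EdgeInserted k G u h
    after-swap (G′ , path , clique′ , (uh′ , ug₁ , ug₂) , unchanged) =
      G′ , path , clique′ , fixed′ , uh′ , keeps
      where
      simpleG = proj₁ (proj₁ clique)
      -- Fixed vertices are far from both u and h, hence untouched.
      fixed′ : FixedBelow k G′
      fixed′ v v<k t =
        trans (unchanged v (fixed-far clique uh u≁h (fixed v v<k))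
                           (fixed-far clique (edge-sym simpleH uh) (u≁h ∘ edge-sym simpleG) (fixed v v<k)) t)
              (fixed v v<k t)
      -- Of the old neighbours g, g₁, g₂ of u, only g was lost, and it is no H-neighbour.
      keeps : Keeps u G G′
      keeps t Hut Gut with Exactly3.only nbrs-u t Gut
      ... | inj₁ refl        = ⊥-elim (u≁Hg Hut)
      ... | inj₂ (inj₁ refl) = ug₁
      ... | inj₂ (inj₂ refl) = ug₂

  -- Inserting the three H-edges at u gives u exactly its H-neighbourhood.
  fix-vertex : ∀ {k G} → CliqueGraph G → FixedBelow k G → ∀ u → toℕ u ≡ k → Reachable (suc k) G
  fix-vertex {k} clique fixed u u≡k with neighbours inH u
  ... | (h₁ , h₂ , h₃ , nbrs-H@(exactly3 distinct (uh₁ , uh₂ , uh₃) _))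
    with insert-edge clique fixed uh₁
  ... | (G₁ , path₁ , clique₁ , fixed₁ , e₁ , _)
    with insert-edge clique₁ fixed₁ uh₂
  ... | (G₂ , path₂ , clique₂ , fixed₂ , e₂ , keeps₂)
    with insert-edge clique₂ fixed₂ uh₃
  ... | (G₃ , path₃ , clique₃ , fixed₃ , e₃ , keeps₃) =
    G₃ , path₁ ◅◅ path₂ ◅◅ path₃ , clique₃ , fixed′
    where
    nbrs-G₃ : Nbrs3 G₃ u h₁ h₂ h₃
    nbrs-G₃ = neighbours-complete (proj₁ clique₃) distinct
                (keeps₃ h₁ uh₁ (keeps₂ h₁ uh₁ e₁) , keeps₃ h₂ uh₂ e₂ , e₃)
    fixed′ : FixedBelow (suc k) G₃
    fixed′ v v<1+k with m<1+n⇒m<n∨m≡n v<1+k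
    ... | inj₁ v<k = fixed₃ v v<k
    ... | inj₂ v≡k = subst (RowsAgree G₃ H) (toℕ-injective (trans u≡k (sym v≡k)))
                           (same-neighbours {G = G₃} {H = H} nbrs-G₃ nbrs-H)

  prepend : ∀ {k G G₁} → Star Adj* G G₁ → Reachable k G₁ → Reachable k G
  prepend path₁ (G₂ , path₂ , clique₂ , fixed₂) = G₂ , path₁ ◅◅ path₂ , clique₂ , fixed₂

  reach : ∀ {G} → CliqueGraph G → ∀ k → k ≤ n → Reachable k G
  reach {G} clique zero    _   = G , ε , clique , λ _ ()
  reach {G} clique (suc k) k<n with reach clique k (<⇒≤ k<n)
  ... | (G₁ , path₁ , clique₁ , fixed₁) =
    prepend path₁ (fix-vertex clique₁ fixed₁ (fromℕ< k<n) (toℕ-fromℕ< k<n))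

  all-fixed : ∀ {G} → Reachable n G → Connected* G H
  all-fixed (G′ , path , _ , fixed) = G′ , path , λ a b → fixed a (toℕ<n a) b

-- The divisibility hypothesis is implied by InK G and not needed.
theorem8 : (n : ℕ) → n % 4 ≡ 0 → (G H : Graph n) → InK G → InK H → Connected* G H
theorem8 n _ G H inK-G inK-H = all-fixed (reach (inK-clique inK-G) n ≤-refl)
  where open Reconfiguration H (inK-clique inK-H)
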